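{- For the Santa Claus problem on $m$ identical machines, $\textsc{Greedy}$ has online bounded ratio $1$.
   Context: Santa Claus problem: jobs with positive sizes arrive online and each must be assigned irrevocably to one of $m$ identical machines; the load of a machine is the total size of its jobs; the goal is to maximize the minimum load over all machines. $\textsc{Greedy}$ assigns each new job to a machine of minimum current load (ties arbitrary). For a deterministic online algorithm $A$ of a maximization problem, $\textsc{Opt}_A$ denotes an offline algorithm that is optimal among offline algorithms whose solution on any input $I$ satisfies, for every prefix $I'$ of $I$, that the value of the solution restricted to $I'$ is at least $A(I')$. The online bounded ratio of $A$ is the supremum of all constants $c$ such that $A(I) \ge c\,\textsc{Opt}_A(I)$ for all inputs $I$.
   Formalization: The job sizes are rational, and the online bounded ratio is the supremum over rational constants $c$ only. -}

module Defs where

open import Data.Nat using (ℕ; zero; suc)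
open import Data.Fin using (Fin; zero; suc; _≟_)
open import Data.Rational using (ℚ; 0ℚ; _+_; _*_; _⊓_; _≤_; _<_)
open import Data.List using (List; []; _∷_; _++_; [_]; map; take)
open import Data.List.Relation.Unary.All using (All)
open import Data.Product using (Σ; _×_; _,_; proj₁)
open import Relation.Nullary using (yes; no)
open import Relation.Binary.PropositionalEquality using (_≡_)

-- A schedule on m machines: the list of (job size, machine) pairs, in arrival order.
Sched : ℕ → Set
Sched m = List (ℚ × Fin m)

load : ∀ {m} → Sched m → Fin m → ℚ
load [] i = 0ℚ
load ((x , j) ∷ s) i with j ≟ i
... | yes _ = x + load s i
... | no  _ = load s i

minFin : ∀ {n} → (Fin (suc n) → ℚ) → ℚ
minFin {zero}  f = f zero
minFin {suc n} f = f zero ⊓ minFin (λ i → f (suc i))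

value : ∀ {n} → Sched (suc n) → ℚ
value s = minFin (load s)

jobs : ∀ {m} → Sched m → List ℚ
jobs s = map proj₁ s

Positive : List ℚ → Set
Positive I = All (λ x → 0ℚ < x) I

-- A deterministic online algorithm: given the jobs seen so far (in order)
-- and the newly arriving job, it irrevocably chooses a machine.
Alg : ℕ → Set
Alg m = List ℚ → ℚ → Fin m

runFrom : ∀ {m} → Alg m → List ℚ → List ℚ → Sched m
runFrom A hist []       = []
runFrom A hist (x ∷ xs) = (x , A hist x) ∷ runFrom A (hist ++ [ x ]) xs

run : ∀ {m} → Alg m → List ℚ → Sched m
run A I = runFrom A [] I

algValue : ∀ {n} → Alg (suc n) → List ℚ → ℚ
algValue A I = value (run A I)

-- Greedy: each new job goes to a machine of minimum current load (ties arbitrary: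
-- any tie-breaking rule is allowed).
IsGreedy : ∀ {m} → Alg m → Set
IsGreedy A = ∀ hist x i → load (run A hist) (A hist x) ≤ load (run A hist) i

-- Offline solutions admissible for Opt_A on input I: schedules of I whose
-- value on every prefix I' of I is at least A(I').
Admissible : ∀ {n} → Alg (suc n) → List ℚ → Sched (suc n) → Set
Admissible A I σ = (jobs σ ≡ I) × (∀ k → algValue A (take k I) ≤ value (take k σ))

IsOptA : ∀ {n} → Alg (suc n) → List ℚ → ℚ → Set
IsOptA A I v =
  Σ (Sched _) (λ σ → Admissible A I σ × value σ ≡ v)
  × (∀ σ → Admissible A I σ → value σ ≤ v)

RatioBound : ∀ {n} → Alg (suc n) → ℚ → Set
RatioBound A c = ∀ I → Positive I → ∀ v → IsOptA A I v → c * v ≤ algValue A I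

OnlineBoundedRatio : ∀ {n} → Alg (suc n) → ℚ → Set
OnlineBoundedRatio A r =
  (∀ c → RatioBound A c → c ≤ r)
  × (∀ b → (∀ c → RatioBound A c → c ≤ b) → r ≤ b)

-- For a threshold h let D_h(s) = Σᵢ min(loadᵢ(s), h), and let σ be admissible for Opt_A.
-- When a job x arrives, σ puts it on a machine of load at least value(σ-prefix) ≥ Greedy(prefix),
-- while Greedy puts it on a machine of load exactly Greedy(prefix). As t ↦ min(t + x, h) − min(t, h)
-- is antitone, D_h(σ-prefix) ≤ D_h(Greedy-prefix) is preserved for every h; at h = value(σ) the
-- left side is m·h, which forces value(σ) ≤ Greedy. So Opt_A = Greedy and ratio 1 is valid. No
-- larger ratio is, since on m equal jobs Greedy's loads stay within one job of each other, so its
-- value is positive.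

module Submission where

open import Defs
open import Data.Nat using (ℕ; suc)
open import Data.Rational using (1ℚ)

open import Data.Nat using (zero)
import Data.Nat.Properties as ℕ
open import Data.Fin using (Fin; zero; suc; _≟_; punchIn)
open import Data.Fin.Properties using (punchInᵢ≢i)
open import Data.Rational using (ℚ; 0ℚ; _+_; _*_; _⊓_; _≤_; _<_; -_; positive)
import Data.Rational.Properties as Q
open import Data.Rational.Solver using (module +-*-Solver)
open import Algebra.Properties.Group Q.+-0-group using (//-rightDividesʳ)
open import Algebra.Properties.CommutativeMonoid.Sum Q.+-0-commutativeMonoid
  using (sum; sum-remove; sum-cong-≗; ∑-distrib-+; sum-replicate-zero)
open import Data.Vec.Functional using (removeAt)
open import Data.List using (List; []; _∷_; _++_; [_]; _∷ʳ_; take; replicate; length; foldr)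
open import Data.List.Properties using (++-assoc; ++-identityʳ; map-++; take-map; take-all)
open import Data.List.Relation.Unary.All using (All; _∷_)
open import Data.List.Relation.Unary.All.Properties using (map⁻; replicate⁺)
open import Data.Product using (∃; _×_; _,_; proj₁)
open import Data.Sum using (_⊎_; inj₁; inj₂)
open import Data.Empty using (⊥-elim)
open import Function using (_∘_)
open import Relation.Nullary using (yes; no)
open import Relation.Binary.PropositionalEquality
  using (_≡_; _≢_; refl; sym; trans; cong; cong₂; subst; subst₂; module ≡-Reasoning)

0<1 : 0ℚ < 1ℚ
0<1 = Q.positive⁻¹ 1ℚ

+-cancelʳ-≤ : ∀ r {p q} → p + r ≤ q + r → p ≤ q
+-cancelʳ-≤ r {p} {q} le = subst₂ _≤_ (//-rightDividesʳ r p) (//-rightDividesʳ r q) (Q.+-monoˡ-≤ (- r) le)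

p≤p+q : ∀ p {q} → 0ℚ ≤ q → p ≤ p + q
p≤p+q p 0≤q = subst (_≤ p + _) (Q.+-identityʳ p) (Q.+-monoʳ-≤ p 0≤q)

⊓-increment-antitone : ∀ h {x y} p → y ≤ x → 0ℚ ≤ p → (x + p) ⊓ h + y ⊓ h ≤ (y + p) ⊓ h + x ⊓ h
⊓-increment-antitone h {x} {y} p y≤x 0≤p with Q.≤-total h x
... | inj₁ h≤x = begin
  (x + p) ⊓ h + y ⊓ h  ≤⟨ Q.+-mono-≤ (Q.p⊓q≤q (x + p) h) (Q.⊓-monoˡ-≤ h (p≤p+q y 0≤p)) ⟩
  h + (y + p) ⊓ h      ≡⟨ Q.+-comm h _ ⟩
  (y + p) ⊓ h + h      ≡⟨ cong ((y + p) ⊓ h +_) (Q.p≥q⇒p⊓q≡q h≤x) ⟨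
  (y + p) ⊓ h + x ⊓ h  ∎
  where open Q.≤-Reasoning
... | inj₂ x≤h = begin
  (x + p) ⊓ h + y ⊓ h          ≡⟨ cong ((x + p) ⊓ h +_) (Q.p≤q⇒p⊓q≡p (Q.≤-trans y≤x x≤h)) ⟩
  (x + p) ⊓ h + y              ≡⟨ Q.mono-≤-distrib-⊓ (Q.+-monoˡ-≤ y) (x + p) h ⟩
  (x + p + y) ⊓ (h + y)        ≤⟨ Q.⊓-mono-≤ (Q.≤-reflexive (solve 3 (λ x p y → x :+ p :+ y := y :+ p :+ x) refl x p y))
                                              (Q.+-monoʳ-≤ h y≤x) ⟩
  (y + p + x) ⊓ (h + x)        ≡⟨ Q.mono-≤-distrib-⊓ (Q.+-monoˡ-≤ x) (y + p) h ⟨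
  (y + p) ⊓ h + x              ≡⟨ cong ((y + p) ⊓ h +_) (Q.p≤q⇒p⊓q≡p x≤h) ⟨
  (y + p) ⊓ h + x ⊓ h          ∎
  where
  open Q.≤-Reasoning
  open +-*-Solver

sum-mono-≤ : ∀ {m} {f g : Fin m → ℚ} → (∀ i → f i ≤ g i) → sum f ≤ sum g
sum-mono-≤ {zero}  f≤g = Q.≤-refl
sum-mono-≤ {suc m} f≤g = Q.+-mono-≤ (f≤g zero) (sum-mono-≤ (f≤g ∘ suc))

sum-mono-< : ∀ {m} {f g : Fin m → ℚ} → (∀ i → f i ≤ g i) → ∀ j → f j < g j → sum f < sum g
sum-mono-< f≤g zero    fj<gj = Q.+-mono-<-≤ fj<gj (sum-mono-≤ (f≤g ∘ suc))
sum-mono-< f≤g (suc j) fj<gj = Q.+-mono-≤-< (f≤g zero) (sum-mono-< (f≤g ∘ suc) j fj<gj)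

sum-update : ∀ {m} {f g : Fin (suc m) → ℚ} j → (∀ i → i ≢ j → f i ≡ g i) → sum f + g j ≡ sum g + f j
sum-update {f = f} {g} j agree = begin
  sum f + g j                        ≡⟨ cong (_+ g j) (sum-remove f) ⟩
  f j + sum (removeAt f j) + g j     ≡⟨ cong (λ t → f j + t + g j) (sum-cong-≗ (λ k → agree (punchIn j k) (punchInᵢ≢i j k))) ⟩
  f j + sum (removeAt g j) + g j     ≡⟨ solve 3 (λ a s b → a :+ s :+ b := b :+ s :+ a) refl (f j) (sum (removeAt g j)) (g j) ⟩
  g j + sum (removeAt g j) + f j     ≡⟨ cong (_+ f j) (sum-remove g) ⟨
  sum g + f j                        ∎
  where
  open ≡-Reasoning
  open +-*-Solver

minFin-≤ : ∀ {n} (f : Fin (suc n) → ℚ) i → minFin f ≤ f i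
minFin-≤ {zero}  f zero    = Q.≤-refl
minFin-≤ {suc n} f zero    = Q.p⊓q≤p _ _
minFin-≤ {suc n} f (suc i) = Q.≤-trans (Q.p⊓q≤q (f zero) _) (minFin-≤ (f ∘ suc) i)

minFin-greatest : ∀ {n} (f : Fin (suc n) → ℚ) {c} → (∀ i → c ≤ f i) → c ≤ minFin f
minFin-greatest {zero}  f c≤f = c≤f zero
minFin-greatest {suc n} f c≤f = Q.⊓-glb (c≤f zero) (minFin-greatest (f ∘ suc) (c≤f ∘ suc))

minFin-attained : ∀ {n} (f : Fin (suc n) → ℚ) → ∃ λ i → f i ≡ minFin f
minFin-attained {zero}  f = zero , refl
minFin-attained {suc n} f with Q.⊓-sel (f zero) (minFin (f ∘ suc))
... | inj₁ eq = zero , sym eq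
... | inj₂ eq with minFin-attained (f ∘ suc)
...   | i , fi≡min = suc i , trans fi≡min (sym eq)

load-++ : ∀ {m} (s t : Sched m) i → load (s ++ t) i ≡ load s i + load t i
load-++ []            t i = sym (Q.+-identityˡ _)
load-++ ((x , j) ∷ s) t i with j ≟ i
... | yes _ = trans (cong (x +_) (load-++ s t i)) (sym (Q.+-assoc x _ _))
... | no  _ = load-++ s t i

load-[]-≡ : ∀ {m} x (j : Fin m) → load [ (x , j) ] j ≡ x
load-[]-≡ x j with j ≟ j
... | yes _  = Q.+-identityʳ x
... | no j≢j = ⊥-elim (j≢j refl)

load-[]-≢ : ∀ {m} x {j i : Fin m} → i ≢ j → load [ (x , j) ] i ≡ 0ℚ
load-[]-≢ x {j} {i} i≢j with j ≟ i
... | yes j≡i = ⊥-elim (i≢j (sym j≡i))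
... | no  _   = refl

load-∷ʳ-≡ : ∀ {m} (s : Sched m) x j → load (s ∷ʳ (x , j)) j ≡ load s j + x
load-∷ʳ-≡ s x j = trans (load-++ s _ j) (cong (load s j +_) (load-[]-≡ x j))

load-∷ʳ-≢ : ∀ {m} (s : Sched m) x {j i} → i ≢ j → load (s ∷ʳ (x , j)) i ≡ load s i
load-∷ʳ-≢ s x {i = i} i≢j = trans (load-++ s _ i) (trans (cong (load s i +_) (load-[]-≢ x i≢j)) (Q.+-identityʳ _))

load-∷ʳ-mono : ∀ {m} (s : Sched m) {x} j i → 0ℚ ≤ x → load s i ≤ load (s ∷ʳ (x , j)) i
load-∷ʳ-mono s j i 0≤x with i ≟ j
... | yes refl = subst (load s i ≤_) (sym (load-∷ʳ-≡ s _ i)) (p≤p+q (load s i) 0≤x)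
... | no  i≢j  = Q.≤-reflexive (sym (load-∷ʳ-≢ s _ i≢j))

value-∷ʳ-mono : ∀ {n} (s : Sched (suc n)) {x} j → 0ℚ ≤ x → value s ≤ value (s ∷ʳ (x , j))
value-∷ʳ-mono s j 0≤x = minFin-greatest _ (λ i → Q.≤-trans (minFin-≤ (load s) i) (load-∷ʳ-mono s j i 0≤x))

total : List ℚ → ℚ
total = foldr _+_ 0ℚ

total-replicate : ∀ m x → total (replicate m x) ≡ sum {m} (λ _ → x)
total-replicate zero    x = refl
total-replicate (suc m) x = cong (x +_) (total-replicate m x)

sum-load-[] : ∀ {n} x (j : Fin (suc n)) → sum (load [ (x , j) ]) ≡ x
sum-load-[] {n} x j = begin
  sum δ                        ≡⟨ sum-remove δ ⟩
  δ j + sum (removeAt δ j)     ≡⟨ cong₂ _+_ (load-[]-≡ x j) (sum-cong-≗ (λ k → load-[]-≢ x (punchInᵢ≢i j k))) ⟩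
  x + sum {n} (λ _ → 0ℚ)       ≡⟨ cong (x +_) (sum-replicate-zero n) ⟩
  x + 0ℚ                       ≡⟨ Q.+-identityʳ x ⟩
  x                            ∎
  where
  open ≡-Reasoning
  δ = load [ (x , j) ]

sum-load : ∀ {n} (s : Sched (suc n)) → sum (load s) ≡ total (jobs s)
sum-load {n} []         = sum-replicate-zero (suc n)
sum-load ((x , j) ∷ s) = begin
  sum (load ((x , j) ∷ s))                           ≡⟨ sum-cong-≗ (load-++ [ (x , j) ] s) ⟩
  sum (λ i → load [ (x , j) ] i + load s i)          ≡⟨ ∑-distrib-+ (load [ (x , j) ]) (load s) ⟩
  sum (load [ (x , j) ]) + sum (load s)              ≡⟨ cong₂ _+_ (sum-load-[] x j) (sum-load s) ⟩
  x + total (jobs s)                                 ∎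
  where open ≡-Reasoning

cappedLoad : ∀ {m} → ℚ → Sched m → ℚ
cappedLoad h s = sum (λ i → load s i ⊓ h)

cappedLoad-∷ʳ : ∀ {n} h (s : Sched (suc n)) x j →
                cappedLoad h (s ∷ʳ (x , j)) + load s j ⊓ h ≡ cappedLoad h s + (load s j + x) ⊓ h
cappedLoad-∷ʳ h s x j = begin
  cappedLoad h (s ∷ʳ (x , j)) + load s j ⊓ h           ≡⟨ sum-update j (λ i i≢j → cong (_⊓ h) (sym (load-∷ʳ-≢ s x i≢j))) ⟨
  cappedLoad h s + load (s ∷ʳ (x , j)) j ⊓ h           ≡⟨ cong (λ t → cappedLoad h s + t ⊓ h) (load-∷ʳ-≡ s x j) ⟩
  cappedLoad h s + (load s j + x) ⊓ h                  ∎
  where open ≡-Reasoning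

cappedLoad-∷ʳ-mono : ∀ {n} h (τ ρ : Sched (suc n)) {x} j g → 0ℚ ≤ x → load ρ g ≤ load τ j →
                     cappedLoad h τ ≤ cappedLoad h ρ → cappedLoad h (τ ∷ʳ (x , j)) ≤ cappedLoad h (ρ ∷ʳ (x , g))
cappedLoad-∷ʳ-mono h τ ρ {x} j g 0≤x a≤b Dτ≤Dρ = +-cancelʳ-≤ (b ⊓ h + a ⊓ h) (begin
  Dτ′ + (b ⊓ h + a ⊓ h)        ≡⟨ Q.+-assoc Dτ′ _ _ ⟨
  Dτ′ + b ⊓ h + a ⊓ h          ≡⟨ cong (_+ a ⊓ h) (cappedLoad-∷ʳ h τ x j) ⟩
  Dτ + (b + x) ⊓ h + a ⊓ h     ≡⟨ Q.+-assoc Dτ _ _ ⟩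
  Dτ + ((b + x) ⊓ h + a ⊓ h)   ≤⟨ Q.+-mono-≤ Dτ≤Dρ (⊓-increment-antitone h x a≤b 0≤x) ⟩
  Dρ + ((a + x) ⊓ h + b ⊓ h)   ≡⟨ Q.+-assoc Dρ _ _ ⟨
  Dρ + (a + x) ⊓ h + b ⊓ h     ≡⟨ cong (_+ b ⊓ h) (cappedLoad-∷ʳ h ρ x g) ⟨
  Dρ′ + a ⊓ h + b ⊓ h          ≡⟨ solve 3 (λ d p q → d :+ p :+ q := d :+ (q :+ p)) refl Dρ′ (a ⊓ h) (b ⊓ h) ⟩
  Dρ′ + (b ⊓ h + a ⊓ h)        ∎)
  where
  open Q.≤-Reasoning
  open +-*-Solver
  a = load ρ g
  b = load τ j
  Dτ = cappedLoad h τ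
  Dρ = cappedLoad h ρ
  Dτ′ = cappedLoad h (τ ∷ʳ (x , j))
  Dρ′ = cappedLoad h (ρ ∷ʳ (x , g))

cappedLoad-at-value : ∀ {n} (s : Sched (suc n)) → sum {suc n} (λ _ → value s) ≤ cappedLoad (value s) s
cappedLoad-at-value s = sum-mono-≤ (λ i → Q.⊓-glb (minFin-≤ (load s) i) Q.≤-refl)

cappedLoad-below : ∀ {n} (s : Sched (suc n)) {h} → value s < h → cappedLoad h s < sum {suc n} (λ _ → h)
cappedLoad-below s {h} v<h with minFin-attained (load s)
... | g , load≡value = sum-mono-< (λ i → Q.p⊓q≤q (load s i) h) g
                         (Q.≤-<-trans (Q.p⊓q≤p (load s g) h) (subst (_< h) (sym load≡value) v<h))

value-≤-by-cappedLoad : ∀ {n} (σ ρ : Sched (suc n)) →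
                        cappedLoad (value σ) σ ≤ cappedLoad (value σ) ρ → value σ ≤ value ρ
value-≤-by-cappedLoad σ ρ Dσ≤Dρ = Q.≮⇒≥ λ ρ<σ →
  Q.<-irrefl refl (Q.≤-<-trans (Q.≤-trans (cappedLoad-at-value σ) Dσ≤Dρ) (cappedLoad-below ρ ρ<σ))

runFrom-∷ʳ : ∀ {m} (A : Alg m) hist I x → runFrom A hist (I ∷ʳ x) ≡ runFrom A hist I ∷ʳ (x , A (hist ++ I) x)
runFrom-∷ʳ A hist []      x = cong (λ H → [ (x , A H x) ]) (sym (++-identityʳ hist))
runFrom-∷ʳ A hist (y ∷ I) x = cong ((y , A hist y) ∷_) (begin
  runFrom A (hist ∷ʳ y) (I ∷ʳ x)       ≡⟨ runFrom-∷ʳ A (hist ∷ʳ y) I x ⟩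
  ρ ∷ʳ (x , A (hist ∷ʳ y ++ I) x)      ≡⟨ cong (λ H → ρ ∷ʳ (x , A H x)) (++-assoc hist [ y ] I) ⟩
  ρ ∷ʳ (x , A (hist ++ y ∷ I) x)       ∎)
  where
  open ≡-Reasoning
  ρ = runFrom A (hist ∷ʳ y) I

run-∷ʳ : ∀ {m} (A : Alg m) I x → run A (I ∷ʳ x) ≡ run A I ∷ʳ (x , A I x)
run-∷ʳ A = runFrom-∷ʳ A []

take-runFrom : ∀ {m} (A : Alg m) k hist I → take k (runFrom A hist I) ≡ runFrom A hist (take k I)
take-runFrom A zero    hist I       = refl
take-runFrom A (suc k) hist []      = refl
take-runFrom A (suc k) hist (x ∷ I) = cong (_ ∷_) (take-runFrom A k (hist ∷ʳ x) I)

jobs-runFrom : ∀ {m} (A : Alg m) hist I → jobs (runFrom A hist I) ≡ I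
jobs-runFrom A hist []      = refl
jobs-runFrom A hist (x ∷ I) = cong (x ∷_) (jobs-runFrom A (hist ∷ʳ x) I)

take-suc-∷ʳ : ∀ {X : Set} {P : X → Set} k {xs : List X} → All P xs →
              take (suc k) xs ≡ take k xs ⊎ ∃ λ x → P x × take (suc k) xs ≡ take k xs ∷ʳ x
take-suc-∷ʳ zero    {[]}    _          = inj₁ refl
take-suc-∷ʳ zero    {x ∷ _} (px ∷ _)   = inj₂ (x , px , refl)
take-suc-∷ʳ (suc k) {[]}    _          = inj₁ refl
take-suc-∷ʳ (suc k) {y ∷ _} (_ ∷ pxs) with take-suc-∷ʳ k pxs
... | inj₁ eq            = inj₁ (cong (y ∷_) eq)
... | inj₂ (x , px , eq) = inj₂ (x , px , cong (y ∷_) eq)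

replicate-∷ʳ : ∀ {X : Set} k (x : X) → replicate (suc k) x ≡ replicate k x ∷ʳ x
replicate-∷ʳ zero    x = refl
replicate-∷ʳ (suc k) x = cong (x ∷_) (replicate-∷ʳ k x)

run-admissible : ∀ {n} (A : Alg (suc n)) I → Admissible A I (run A I)
run-admissible A I = jobs-runFrom A [] I , λ k → Q.≤-reflexive (cong value (sym (take-runFrom A k [] I)))

Balanced : ∀ {n} → ℚ → Sched (suc n) → Set
Balanced p s = ∀ i → load s i ≤ value s + p

balanced-∷ʳ-min : ∀ {n} {p} (s : Sched (suc n)) g → 0ℚ ≤ p → load s g ≤ value s →
                  Balanced p s → Balanced p (s ∷ʳ (p , g))
balanced-∷ʳ-min {p = p} s g 0≤p g-min balanced i =
  Q.≤-trans (load-bound i) (Q.+-monoˡ-≤ p (value-∷ʳ-mono s g 0≤p))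
  where
  load-bound : ∀ i → load (s ∷ʳ (p , g)) i ≤ value s + p
  load-bound i with i ≟ g
  ... | yes refl = Q.≤-trans (Q.≤-reflexive (load-∷ʳ-≡ s p i)) (Q.+-monoˡ-≤ p g-min)
  ... | no  i≢g  = Q.≤-trans (Q.≤-reflexive (load-∷ʳ-≢ s p i≢g)) (balanced i)

module Greedy {n} (A : Alg (suc n)) (greedy : IsGreedy A) where

  greedy-load≤value : ∀ I x → load (run A I) (A I x) ≤ algValue A I
  greedy-load≤value I x = minFin-greatest (load (run A I)) (greedy I x)

  Dominated : ℚ → Sched (suc n) → Set
  Dominated h τ = cappedLoad h τ ≤ cappedLoad h (run A (jobs τ))

  dominated-∷ʳ : ∀ h τ {x} j → 0ℚ ≤ x → algValue A (jobs τ) ≤ value τ →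
                 Dominated h τ → Dominated h (τ ∷ʳ (x , j))
  dominated-∷ʳ h τ {x} j 0≤x feasible dominated =
    subst (λ ρ → cappedLoad h (τ ∷ʳ (x , j)) ≤ cappedLoad h ρ) (sym run-eq)
      (cappedLoad-∷ʳ-mono h τ (run A (jobs τ)) j (A (jobs τ) x) 0≤x greedy-below dominated)
    where
    run-eq : run A (jobs (τ ∷ʳ (x , j))) ≡ run A (jobs τ) ∷ʳ (x , A (jobs τ) x)
    run-eq = trans (cong (run A) (map-++ proj₁ τ [ (x , j) ])) (run-∷ʳ A (jobs τ) x)
    greedy-below : load (run A (jobs τ)) (A (jobs τ) x) ≤ load τ j
    greedy-below = Q.≤-trans (greedy-load≤value (jobs τ) x) (Q.≤-trans feasible (minFin-≤ (load τ) j))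

  prefix-dominated : ∀ σ → All (λ e → 0ℚ < proj₁ e) σ →
                     (∀ k → algValue A (jobs (take k σ)) ≤ value (take k σ)) → ∀ h k → Dominated h (take k σ)
  prefix-dominated σ pos feasible h zero = Q.≤-refl
  prefix-dominated σ pos feasible h (suc k) with take-suc-∷ʳ k pos
  ... | inj₁ eq = subst (Dominated h) (sym eq) (prefix-dominated σ pos feasible h k)
  ... | inj₂ ((x , j) , 0<x , eq) = subst (Dominated h) (sym eq)
    (dominated-∷ʳ h (take k σ) j (Q.<⇒≤ 0<x) (feasible k) (prefix-dominated σ pos feasible h k))

  admissible⇒value≤ : ∀ {I σ} → Positive I → Admissible A I σ → value σ ≤ algValue A I
  admissible⇒value≤ {σ = σ} pos (refl , feasible) =
    value-≤-by-cappedLoad σ (run A (jobs σ))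
      (subst (Dominated (value σ)) (take-all (length σ) σ ℕ.≤-refl)
        (prefix-dominated σ (map⁻ pos) feasible′ (value σ) (length σ)))
    where
    feasible′ : ∀ k → algValue A (jobs (take k σ)) ≤ value (take k σ)
    feasible′ k = subst (λ J → algValue A J ≤ value (take k σ)) (take-map k σ) (feasible k)

  greedy-isOptA : ∀ {I} → Positive I → IsOptA A I (algValue A I)
  greedy-isOptA {I} pos = (run A I , run-admissible A I , refl) , λ σ → admissible⇒value≤ pos

  greedy-replicate-balanced : ∀ {p} → 0ℚ ≤ p → ∀ k → Balanced p (run A (replicate k p))
  greedy-replicate-balanced {p} 0≤p zero i =
    subst (_≤ value {n} [] + p) (Q.+-identityˡ 0ℚ) (Q.+-mono-≤ (minFin-greatest (load {suc n} []) (λ _ → Q.≤-refl)) 0≤p)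
  greedy-replicate-balanced {p} 0≤p (suc k) =
    subst (Balanced p) (sym (trans (cong (run A) (replicate-∷ʳ k p)) (run-∷ʳ A I p)))
      (balanced-∷ʳ-min (run A I) (A I p) 0≤p (greedy-load≤value I p) (greedy-replicate-balanced 0≤p k))
    where I = replicate k p

  greedy-replicate-value-pos : ∀ {p} → 0ℚ < p → 0ℚ < algValue A (replicate (suc n) p)
  greedy-replicate-value-pos {p} 0<p = Q.≰⇒> λ v≤0 → Q.<-irrefl loads-total (loads-below v≤0)
    where
    I = replicate (suc n) p
    s = run A I
    loads-total : sum (load s) ≡ sum {suc n} (λ _ → p)
    loads-total = trans (sum-load s) (trans (cong total (jobs-runFrom A [] I)) (total-replicate (suc n) p))
    loads-below : algValue A I ≤ 0ℚ → sum (load s) < sum {suc n} (λ _ → p)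
    loads-below v≤0 with minFin-attained (load s)
    ... | g , load≡value =
      sum-mono-< (λ i → Q.≤-trans (greedy-replicate-balanced (Q.<⇒≤ 0<p) (suc n) i) value+p≤p) g
        (Q.≤-<-trans (subst (_≤ 0ℚ) (sym load≡value) v≤0) 0<p)
      where
      value+p≤p : algValue A I + p ≤ p
      value+p≤p = subst (algValue A I + p ≤_) (Q.+-identityˡ p) (Q.+-monoˡ-≤ p v≤0)

theorem6 : (n : ℕ) (A : Alg (suc n)) → IsGreedy A → OnlineBoundedRatio A 1ℚ
theorem6 n A greedy = valid⇒≤1 , λ b bound → bound 1ℚ ratio-1-valid
  where
  open Greedy A greedy

  ratio-1-valid : RatioBound A 1ℚ
  ratio-1-valid I pos v ((σ , admissible , refl) , _) =
    subst (_≤ algValue A I) (sym (Q.*-identityˡ (value σ))) (admissible⇒value≤ pos admissible)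

  valid⇒≤1 : ∀ c → RatioBound A c → c ≤ 1ℚ
  valid⇒≤1 c bound = Q.*-cancelʳ-≤-pos v {{positive (greedy-replicate-value-pos 0<1)}}
    (subst (c * v ≤_) (sym (Q.*-identityˡ v)) (bound I I-pos v (greedy-isOptA I-pos)))
    where
    I = replicate (suc n) 1ℚ
    I-pos = replicate⁺ (suc n) 0<1
    v = algValue A I
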